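{- Let $n\ge4$ and let $T$ be the path with $n+1$ vertices labelled $1,2,\ldots,n+1$ consecutively. Then every cycle arising as a product of the edge-transpositions of $T$ (over orderings of its edges), other than $(1,2,\ldots,n+1)$ and its inverse, has multiplicity at least $n-1$, and the cycles of multiplicity exactly $n-1$ are precisely $(1,2,\ldots,n-1,n+1,n)$, $(1,3,4,\ldots,n,n+1,2)$ and their inverses. (That is, these four are the second least frequent cycles, with multiplicity $n-1$.)
   Context: Each edge $\{i,i+1\}$ is regarded as the transposition $(i,i+1)$; an ordering lists every edge exactly once; the multiplicity of a cycle is the number of orderings whose product is that cycle. -}

module Defs where

open import Data.Nat using (ℕ; zero; suc; _+_; _∸_)
open import Data.Fin using (Fin; toℕ; inject₁; _≟_)
open import Data.Fin.Properties using (all?)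
open import Data.List using (List; []; _∷_; [_]; map; concatMap; foldr; length; filter; allFin)
open import Data.Bool using (if_then_else_)
open import Relation.Nullary.Decidable using (does)
open import Relation.Binary.PropositionalEquality using (_≡_)
open import Function using (_∘_; id)

-- Vertices of the path T on n+1 vertices: Fin (suc n); vertex k has label (toℕ k + 1).
-- Edges of T: Fin n; edge i joins vertices i and i+1 (labels i+1 and i+2).

swap : ∀ {m} → Fin m → Fin m → Fin m → Fin m
swap a b k = if does (k ≟ a) then b else (if does (k ≟ b) then a else k)

edgeTransp : ∀ {n} → Fin n → Fin (suc n) → Fin (suc n)
edgeTransp i = swap (inject₁ i) (Data.Fin.suc i)

-- Product of the edge-transpositions in a given ordering (composition of functions,
-- first edge of the list applied last; the multiplicity function does not depend on
-- this convention, since reversing orderings is a bijection).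
product : ∀ {n} → List (Fin n) → Fin (suc n) → Fin (suc n)
product = foldr (λ e f → edgeTransp e ∘ f) id

insertions : ∀ {A : Set} → A → List A → List (List A)
insertions x [] = [ [ x ] ]
insertions x (y ∷ ys) = (x ∷ y ∷ ys) ∷ map (y ∷_) (insertions x ys)

perms : ∀ {A : Set} → List A → List (List A)
perms [] = [ [] ]
perms (x ∷ xs) = concatMap (insertions x) (perms xs)

orderings : ∀ n → List (List (Fin n))
orderings n = perms (allFin n)

multiplicity : ∀ n → (Fin (suc n) → Fin (suc n)) → ℕ
multiplicity n σ =
  length (filter (λ o → all? (λ k → product o k ≟ σ k)) (orderings n))

-- Cycle notation on labels: cycleℕ (a₁ ∷ … ∷ aₘ) sends aᵢ ↦ aᵢ₊₁, aₘ ↦ a₁,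
-- and fixes every other label.
cycleℕ : List ℕ → ℕ → ℕ
cycleℕ [] k = k
cycleℕ (a ∷ as) k = go a as
  where
  go : ℕ → List ℕ → ℕ
  go x [] = if does (Data.Nat._≟_ k x) then a else k
  go x (y ∷ ys) = if does (Data.Nat._≟_ k x) then y else go y ys

IsCycle : ∀ n → (Fin (suc n) → Fin (suc n)) → List ℕ → Set
IsCycle n σ l = ∀ (k : Fin (suc n)) → suc (toℕ (σ k)) ≡ cycleℕ l (suc (toℕ k))

cycFull : ℕ → List ℕ
cycFull n = map suc (Data.List.upTo (suc n))

cycA : ℕ → List ℕ
cycA n = Data.List._++_ (map suc (Data.List.upTo (n ∸ 1))) (suc n ∷ n ∷ [])

cycB : ℕ → List ℕ
cycB n = 1 ∷ Data.List._++_ (map (3 +_) (Data.List.upTo (n ∸ 1))) [ 2 ]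

-- Transpositions of non-adjacent edges commute, so the product of an ordering depends only on its
-- pattern: for each pair of consecutive edges, which one comes first. Distinct patterns give distinct
-- products, so the multiplicity of a product is the number of orderings with one given pattern.
-- Inserting the first edge into an ordering of the remaining ones counts these orderings by a
-- recursion in which position weights become prefix or suffix sums. Bounding those sums shows that
-- every pattern is realised at least n times, except the two constant patterns (the cycle
-- (1 2 … n+1) and its inverse, realised once) and T…TF, F…FT, FT…T, TF…F, realised n − 1 times;
-- these four produce (1 … n−1 n+1 n), its inverse, (1 3 4 … n+1 2) and its inverse.

module Submission where

open import Defs
open import Data.Nat using (ℕ; zero; suc; _+_; _*_; _∸_; _≤_; _<_; z≤n; s≤s)
open import Data.Nat.Properties
open import Data.Fin as Fin using (Fin; toℕ; inject₁; fromℕ<)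
open import Data.Fin.Properties using (toℕ-injective; toℕ-inject₁; toℕ-fromℕ<; toℕ≤pred[n]; all?)
open import Data.Bool using (Bool; true; false; if_then_else_; _∧_; not)
import Data.Bool.Properties as Bool
open import Data.List using (List; []; _∷_; [_]; length; map; foldr; concatMap; filter; replicate; _++_; reverse)
open import Data.List using (tabulate; allFin; upTo; applyUpTo)
open import Data.List.Properties using (length-replicate; length-++; map-replicate; reverse-++; unfold-reverse; ++-assoc; ≡-dec)
open import Data.List.Properties using (map-∘; map-++; map-cong; map-cong-local; map-upTo; map-tabulate)
open import Data.List.Properties using (map-concatMap; concatMap-map; concatMap-cong)
open import Data.Nat.ListAction using (sum)
open import Data.Nat.ListAction.Properties using (sum-++)
open import Data.List.Relation.Unary.All as All using (All; []; _∷_)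
open import Data.List.Relation.Unary.All.Properties using (map⁺; concat⁺)
open import Data.List.Relation.Unary.Any using (here; there)
open import Data.List.Relation.Unary.Any.Properties using (reverse⁺)
open import Data.List.Relation.Unary.Unique.Propositional using (Unique; []; _∷_)
open import Data.List.Membership.Propositional using (_∈_; _∉_)
open import Data.List.Membership.Propositional.Properties using (∈-map⁺; ∈-++⁺ˡ; ∈-++⁺ʳ)
open import Data.List.Relation.Binary.Permutation.Propositional as ↭ using (_↭_; ↭⇒↭ₛ)
open import Data.List.Relation.Binary.Permutation.Propositional.Properties using (All-resp-↭; ∈-resp-↭; ↭-length)
open import Data.Product using (_×_; _,_; ∃)
open import Data.Sum using (_⊎_; inj₁; inj₂)
open import Data.Empty using (⊥; ⊥-elim)
open import Relation.Nullary using (¬_; Dec; yes; no; does)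
open import Relation.Nullary.Decidable using (dec-true; dec-false; does-⇔)
open import Relation.Unary using (Decidable)
open import Relation.Binary.PropositionalEquality hiding ([_])
open import Data.List.Relation.Binary.Permutation.Setoid.Properties (setoid ℕ) using (Unique-resp-↭)
open import Function using (_∘_; id; const)
open import Function.Bundles using (_⇔_; mk⇔)

swapAdj : ℕ → ℕ → ℕ
swapAdj zero    zero          = 1
swapAdj zero    (suc zero)    = 0
swapAdj zero    (suc (suc v)) = suc (suc v)
swapAdj (suc e) zero          = zero
swapAdj (suc e) (suc v)       = suc (swapAdj e v)

swapAdj-here : ∀ e → swapAdj e e ≡ suc e
swapAdj-here zero    = refl
swapAdj-here (suc e) = cong suc (swapAdj-here e)

swapAdj-there : ∀ e → swapAdj e (suc e) ≡ e
swapAdj-there zero    = refl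
swapAdj-there (suc e) = cong suc (swapAdj-there e)

swapAdj-below : ∀ {e v} → v < e → swapAdj e v ≡ v
swapAdj-below {suc e} {zero}  _         = refl
swapAdj-below {suc e} {suc v} (s≤s v<e) = cong suc (swapAdj-below v<e)

swapAdj-above : ∀ {e v} → 2 + e ≤ v → swapAdj e v ≡ v
swapAdj-above {zero}  {suc zero}    (s≤s ())
swapAdj-above {zero}  {suc (suc v)} _          = refl
swapAdj-above {suc e} {suc v}       (s≤s 2+e≤v) = cong suc (swapAdj-above 2+e≤v)

swapAdj-fixes : ∀ {e v} → v ≢ e → v ≢ suc e → swapAdj e v ≡ v
swapAdj-fixes {zero}  {zero}        v≢e _      = ⊥-elim (v≢e refl)
swapAdj-fixes {zero}  {suc zero}    _   v≢1+e  = ⊥-elim (v≢1+e refl)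
swapAdj-fixes {zero}  {suc (suc v)} _   _      = refl
swapAdj-fixes {suc e} {zero}        _   _      = refl
swapAdj-fixes {suc e} {suc v}       v≢e v≢1+e =
  cong suc (swapAdj-fixes (v≢e ∘ cong suc) (v≢1+e ∘ cong suc))

swapAdj-involutive : ∀ e v → swapAdj e (swapAdj e v) ≡ v
swapAdj-involutive zero    zero          = refl
swapAdj-involutive zero    (suc zero)    = refl
swapAdj-involutive zero    (suc (suc v)) = refl
swapAdj-involutive (suc e) zero          = refl
swapAdj-involutive (suc e) (suc v)       = cong suc (swapAdj-involutive e v)

swapAdj-comm : ∀ {a b} v → 2 + b ≤ a → swapAdj a (swapAdj b v) ≡ swapAdj b (swapAdj a v)
swapAdj-comm {suc (suc a)} {zero}  zero          _               = refl
swapAdj-comm {suc (suc a)} {zero}  (suc zero)    _               = refl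
swapAdj-comm {suc (suc a)} {zero}  (suc (suc v)) _               = refl
swapAdj-comm {suc zero}    {zero}  _             (s≤s ())
swapAdj-comm {suc a}       {suc b} zero          _               = refl
swapAdj-comm {suc a}       {suc b} (suc v)       (s≤s 2+b≤a) = cong suc (swapAdj-comm v 2+b≤a)

swapAdj-≤ : ∀ {e v N} → e < N → v ≤ N → swapAdj e v ≤ N
swapAdj-≤ {zero}  {zero}        e<N _           = e<N
swapAdj-≤ {zero}  {suc zero}    _   _           = z≤n
swapAdj-≤ {zero}  {suc (suc v)} _   v≤N         = v≤N
swapAdj-≤ {suc e} {zero}        _   _           = z≤n
swapAdj-≤ {suc e} {suc v}       (s≤s e<N) (s≤s v≤N) = s≤s (swapAdj-≤ e<N v≤N)

toℕ-edgeTransp : ∀ {n} (e : Fin n) (v : Fin (suc n)) →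
                 toℕ (edgeTransp e v) ≡ swapAdj (toℕ e) (toℕ v)
toℕ-edgeTransp e v with v Fin.≟ inject₁ e
... | yes refl = sym (trans (cong (swapAdj (toℕ e)) (toℕ-inject₁ e)) (swapAdj-here (toℕ e)))
... | no v≢e with v Fin.≟ Fin.suc e
...   | yes refl = trans (toℕ-inject₁ e) (sym (swapAdj-there (toℕ e)))
...   | no v≢1+e = sym (swapAdj-fixes (λ eq → v≢e (toℕ-injective (trans eq (sym (toℕ-inject₁ e)))))
                                        (v≢1+e ∘ toℕ-injective))

attachSwap : Bool → ℕ → (ℕ → ℕ) → ℕ → ℕ
attachSwap true  s f v = swapAdj s (f v)
attachSwap false s f v = f (swapAdj s v)

attachSwap-cong : ∀ b s {f g : ℕ → ℕ} → (∀ v → f v ≡ g v) → ∀ v → attachSwap b s f v ≡ attachSwap b s g v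
attachSwap-cong true  s f≗g v = cong (swapAdj s) (f≗g v)
attachSwap-cong false s f≗g v = f≗g (swapAdj s v)

-- The product of (s s+1), …, (s+k s+k+1), k = length P, in any order in which
-- (s+i s+i+1) precedes (s+i+1 s+i+2) exactly when the i-th bit of P is true.
zigzag : ℕ → List Bool → ℕ → ℕ
zigzag s []      = swapAdj s
zigzag s (b ∷ P) = attachSwap b s (zigzag (suc s) P)

zigzag-below : ∀ {s v} P → v < s → zigzag s P v ≡ v
zigzag-below []          v<s = swapAdj-below v<s
zigzag-below {s} (true ∷ P)  v<s =
  trans (cong (swapAdj s) (zigzag-below P (m<n⇒m<1+n v<s))) (swapAdj-below v<s)
zigzag-below {s} (false ∷ P) v<s =
  trans (cong (zigzag (suc s) P) (swapAdj-below v<s)) (zigzag-below P (m<n⇒m<1+n v<s))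

zigzag-true-start : ∀ s P → zigzag s (true ∷ P) s ≡ suc s
zigzag-true-start s P = trans (cong (swapAdj s) (zigzag-below P (n<1+n s))) (swapAdj-here s)

zigzag-false-start : ∀ s P → zigzag s (false ∷ P) s ≡ zigzag (suc s) P (suc s)
zigzag-false-start s P = cong (zigzag (suc s) P) (swapAdj-here s)

zigzag-start : ∀ s P → s < zigzag s P s
zigzag-start s []          = ≤-reflexive (sym (swapAdj-here s))
zigzag-start s (true ∷ P)  = ≤-reflexive (sym (zigzag-true-start s P))
zigzag-start s (false ∷ P) =
  subst (s <_) (sym (zigzag-false-start s P)) (<-trans (n<1+n s) (zigzag-start (suc s) P))

zigzag-head-injective : ∀ {s b c} P Q → zigzag s (b ∷ P) s ≡ zigzag s (c ∷ Q) s → b ≡ c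
zigzag-head-injective {b = true}  {true}  _ _ _  = refl
zigzag-head-injective {b = false} {false} _ _ _  = refl
zigzag-head-injective {s} {true}  {false} P Q eq = ⊥-elim (<-irrefl
  (trans (sym (zigzag-true-start s P)) (trans eq (zigzag-false-start s Q))) (zigzag-start (suc s) Q))
zigzag-head-injective {s} {false} {true}  P Q eq = ⊥-elim (<-irrefl
  (trans (sym (zigzag-true-start s Q)) (trans (sym eq) (zigzag-false-start s P))) (zigzag-start (suc s) P))

zigzag-tail : ∀ {N s} b P Q → s < N →
              (∀ v → v ≤ N → zigzag s (b ∷ P) v ≡ zigzag s (b ∷ Q) v) →
              ∀ v → v ≤ N → zigzag (suc s) P v ≡ zigzag (suc s) Q v
zigzag-tail {s = s} true P Q _ eq v v≤N =
  trans (sym (swapAdj-involutive s _)) (trans (cong (swapAdj s) (eq v v≤N)) (swapAdj-involutive s _))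
zigzag-tail {s = s} false P Q s<N eq v v≤N =
  trans (cong (zigzag (suc s) P) (sym (swapAdj-involutive s v)))
        (trans (eq (swapAdj s v) (swapAdj-≤ s<N v≤N)) (cong (zigzag (suc s) Q) (swapAdj-involutive s v)))

zigzag-injective : ∀ {N s} P Q → length P ≡ length Q → s + length P < N →
                   (∀ v → v ≤ N → zigzag s P v ≡ zigzag s Q v) → P ≡ Q
zigzag-injective []      []      _     _  _  = refl
zigzag-injective {N} {s} (b ∷ P) (c ∷ Q) |P|≡|Q| lt eq
  with zigzag-head-injective {b = b} {c} P Q (eq s (<⇒≤ (<-trans (m<m+n s (s≤s z≤n)) lt)))
... | refl = cong (b ∷_) (zigzag-injective P Q (suc-injective |P|≡|Q|) (subst (_< N) (+-suc s (length P)) lt)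
                           (zigzag-tail b P Q (<-trans (m<m+n s (s≤s z≤n)) lt) eq))

productℕ : List ℕ → ℕ → ℕ
productℕ = foldr (λ e f → swapAdj e ∘ f) id

toℕ-product : ∀ {n} (o : List (Fin n)) v → toℕ (product o v) ≡ productℕ (map toℕ o) (toℕ v)
toℕ-product []      v = refl
toℕ-product (e ∷ o) v = trans (toℕ-edgeTransp e (product o v)) (cong (swapAdj (toℕ e)) (toℕ-product o v))

interval : ℕ → ℕ → List ℕ
interval s zero    = []
interval s (suc m) = s ∷ interval (suc s) m

interval-≥ : ∀ s m → All (s ≤_) (interval s m)
interval-≥ s zero    = []
interval-≥ s (suc m) = ≤-refl ∷ All.map (≤-trans (n≤1+n s)) (interval-≥ (suc s) m)

interval-unique : ∀ s m → Unique (interval s m)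
interval-unique s zero    = []
interval-unique s (suc m) =
  All.map (λ 1+s≤x s≡x → <-irrefl s≡x 1+s≤x) (interval-≥ (suc s) m) ∷ interval-unique (suc s) m

length-interval : ∀ s m → length (interval s m) ≡ m
length-interval s zero    = refl
length-interval s (suc m) = cong suc (length-interval (suc s) m)

interval-snoc : ∀ s j → interval s (suc j) ≡ interval s j ++ [ s + j ]
interval-snoc s zero    = cong [_] (sym (+-identityʳ s))
interval-snoc s (suc j) = cong (s ∷_) (trans (interval-snoc (suc s) j) (cong (λ x → interval (suc s) j ++ [ x ]) (sym (+-suc s j))))

∈-interval : ∀ {s k} j → s ≤ k → k < s + j → k ∈ interval s j
∈-interval {s}     zero    s≤k k<s+0 = ⊥-elim (<-irrefl refl (<-≤-trans k<s+0 (≤-trans (≤-reflexive (+-identityʳ s)) s≤k)))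
∈-interval {s} {k} (suc j) s≤k k<s+1+j with m≤n⇒m<n∨m≡n s≤k
... | inj₂ refl = here refl
... | inj₁ s<k  = there (∈-interval j s<k (subst (k <_) (+-suc s j) k<s+1+j))

map-upTo-interval : ∀ (f : ℕ → ℕ) s j → (∀ i → f i ≡ s + i) → map f (upTo j) ≡ interval s j
map-upTo-interval f s j f≗ = trans (map-upTo f j) (applyUpTo-interval f s j f≗)
  where
  applyUpTo-interval : ∀ (f : ℕ → ℕ) s j → (∀ i → f i ≡ s + i) → applyUpTo f j ≡ interval s j
  applyUpTo-interval f s zero    _  = refl
  applyUpTo-interval f s (suc j) f≗ = cong₂ _∷_ (trans (f≗ 0) (+-identityʳ s))
    (applyUpTo-interval (f ∘ suc) (suc s) j (λ i → trans (f≗ (suc i)) (+-suc s i)))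

precedes : List ℕ → ℕ → ℕ → Bool
precedes []      a b = false
precedes (z ∷ o) a b = if does (z ≟ a) then true else if does (z ≟ b) then false else precedes o a b

precedes-here : ∀ a b o → precedes (a ∷ o) a b ≡ true
precedes-here a b o rewrite dec-true (a ≟ a) refl = refl

precedes-blocked : ∀ {a b} o → b ≢ a → precedes (b ∷ o) a b ≡ false
precedes-blocked {a} {b} o b≢a rewrite dec-false (b ≟ a) b≢a | dec-true (b ≟ b) refl = refl

precedes-skip : ∀ {a b z} o → z ≢ a → z ≢ b → precedes (z ∷ o) a b ≡ precedes o a b
precedes-skip {a} {b} {z} o z≢a z≢b rewrite dec-false (z ≟ a) z≢a | dec-false (z ≟ b) z≢b = refl

patternOf : List ℕ → List ℕ → List Bool
patternOf (x ∷ y ∷ xs) o = precedes o x y ∷ patternOf (y ∷ xs) o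
patternOf _            o = []

length-patternOf : ∀ x xs o → length (patternOf (x ∷ xs) o) ≡ length xs
length-patternOf x []       o = refl
length-patternOf x (y ∷ xs) o = cong suc (length-patternOf y xs o)

insertions-↭ : ∀ {A : Set} (x : A) xs → All (_↭ x ∷ xs) (insertions x xs)
insertions-↭ x []       = ↭.refl ∷ []
insertions-↭ x (y ∷ ys) =
  ↭.refl ∷ map⁺ (All.map (λ o↭x∷ys → ↭.trans (↭.prep y o↭x∷ys) (↭.swap y x ↭.refl)) (insertions-↭ x ys))

perms-↭ : ∀ {A : Set} (xs : List A) → All (_↭ xs) (perms xs)
perms-↭ []       = ↭.refl ∷ []
perms-↭ (x ∷ xs) = concat⁺ (map⁺ (All.map
  (λ {o} o↭xs → All.map (λ p → ↭.trans p (↭.prep x o↭xs)) (insertions-↭ x o)) (perms-↭ xs)))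

precedes-insertions : ∀ x o → All (λ o′ → ∀ {a b} → a ≢ x → b ≢ x → precedes o′ a b ≡ precedes o a b)
                                  (insertions x o)
precedes-insertions x []       = (λ a≢x b≢x → precedes-skip [] (a≢x ∘ sym) (b≢x ∘ sym)) ∷ []
precedes-insertions x (z ∷ o)  =
  (λ a≢x b≢x → precedes-skip (z ∷ o) (a≢x ∘ sym) (b≢x ∘ sym)) ∷
  map⁺ (All.map (λ same {a} {b} a≢x b≢x →
                   cong (λ t → if does (z ≟ a) then true else if does (z ≟ b) then false else t) (same a≢x b≢x))
                (precedes-insertions x o))

patternOf-insertion : ∀ {x o o′} xs → All (_≢ x) xs →
                      (∀ {a b} → a ≢ x → b ≢ x → precedes o′ a b ≡ precedes o a b) →
                      patternOf xs o′ ≡ patternOf xs o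
patternOf-insertion []           _                   _    = refl
patternOf-insertion (a ∷ [])     _                   _    = refl
patternOf-insertion (a ∷ b ∷ xs) (a≢x ∷ b≢x ∷ xs≢x) same =
  cong₂ _∷_ (same a≢x b≢x) (patternOf-insertion (b ∷ xs) (b≢x ∷ xs≢x) same)

swapAdj-productℕ : ∀ {s} ys → All (2 + s ≤_) ys → ∀ v → swapAdj s (productℕ ys v) ≡ productℕ ys (swapAdj s v)
swapAdj-productℕ []       []               v = refl
swapAdj-productℕ (y ∷ ys) (2+s≤y ∷ 2+s≤ys) v =
  trans (sym (swapAdj-comm (productℕ ys v) 2+s≤y)) (cong (swapAdj y) (swapAdj-productℕ ys 2+s≤ys v))

productℕ-insertions-commuting : ∀ s ys → All (2 + s ≤_) ys →
  All (λ o → ∀ v → productℕ o v ≡ productℕ ys (swapAdj s v)) (insertions s ys)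
productℕ-insertions-commuting s []       []                 = (λ v → refl) ∷ []
productℕ-insertions-commuting s (y ∷ ys) (2+s≤y ∷ 2+s≤ys) =
  swapAdj-productℕ (y ∷ ys) (2+s≤y ∷ 2+s≤ys) ∷
  map⁺ (All.map (λ o≗ v → cong (swapAdj y) (o≗ v)) (productℕ-insertions-commuting s ys 2+s≤ys))

swapAdj-attachSwap : ∀ {s y} b f v → 2 + s ≤ y →
                     swapAdj y (attachSwap b s f v) ≡ attachSwap b s (swapAdj y ∘ f) v
swapAdj-attachSwap true  f v 2+s≤y = swapAdj-comm (f v) 2+s≤y
swapAdj-attachSwap false f v _     = refl

-- Only (s+1 s+2) fails to commute with (s s+1), so the position of s relative to s+1 is all that matters.
productℕ-insertions : ∀ s o → All (suc s ≤_) o → Unique o →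
  All (λ o′ → ∀ v → productℕ o′ v ≡ attachSwap (precedes o′ s (suc s)) s (productℕ o) v) (insertions s o)
productℕ-insertions s [] _ _ = (λ v → cong (λ b → attachSwap b s id v) (sym (precedes-here s (suc s) []))) ∷ []
productℕ-insertions s (y ∷ ys) (1+s≤y ∷ 1+s≤ys) (y∉ys ∷ ys-unique) =
  (λ v → cong (λ b → attachSwap b s (productℕ (y ∷ ys)) v) (sym (precedes-here s (suc s) (y ∷ ys)))) ∷
  map⁺ (insertBehind (y ≟ suc s))
  where
  y≢s : y ≢ s
  y≢s y≡s = <-irrefl (sym y≡s) 1+s≤y
  insertBehind : Dec (y ≡ suc s) →
    All (λ o′ → ∀ v → productℕ (y ∷ o′) v ≡ attachSwap (precedes (y ∷ o′) s (suc s)) s (productℕ (y ∷ ys)) v)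
        (insertions s ys)
  insertBehind (yes refl) = All.map
    (λ {o′} o′≗ v → trans (cong (swapAdj y) (o′≗ v))
                      (cong (λ b → attachSwap b s (productℕ (y ∷ ys)) v) (sym (precedes-blocked o′ y≢s))))
    (productℕ-insertions-commuting s ys (All.zipWith (λ (1+s≤z , y≢z) → ≤∧≢⇒< 1+s≤z y≢z) (1+s≤ys , y∉ys)))
  insertBehind (no y≢1+s) = All.map
    (λ {o′} o′≗ v → trans (cong (swapAdj y) (o′≗ v))
                      (trans (swapAdj-attachSwap (precedes o′ s (suc s)) (productℕ ys) v (≤∧≢⇒< 1+s≤y (y≢1+s ∘ sym)))
                        (cong (λ b → attachSwap b s (productℕ (y ∷ ys)) v) (sym (precedes-skip o′ y≢s y≢1+s)))))
    (productℕ-insertions s ys 1+s≤ys ys-unique)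

productℕ-zigzag : ∀ s m → All (λ o → ∀ v → productℕ o v ≡ zigzag s (patternOf (interval s (suc m)) o) v)
                              (perms (interval s (suc m)))
productℕ-zigzag s zero    = (λ v → refl) ∷ []
productℕ-zigzag s (suc m) =
  concat⁺ (map⁺ (All.map insertFirst (All.zip (productℕ-zigzag (suc s) m , perms-↭ R))))
  where
  R = interval (suc s) (suc m)
  R≢s : All (_≢ s) R
  R≢s = All.map (λ 1+s≤x x≡s → <-irrefl (sym x≡s) 1+s≤x) (interval-≥ (suc s) (suc m))
  insertFirst : ∀ {o} → (∀ v → productℕ o v ≡ zigzag (suc s) (patternOf R o) v) × (o ↭ R) →
    All (λ o′ → ∀ v → productℕ o′ v ≡ zigzag s (patternOf (s ∷ R) o′) v) (insertions s o)
  insertFirst {o} (o≗ , o↭R) = All.zipWith (λ {o′} → step {o′})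
    ( productℕ-insertions s o (All-resp-↭ (↭.↭-sym o↭R) (interval-≥ (suc s) (suc m)))
                              (Unique-resp-↭ (↭⇒↭ₛ (↭.↭-sym o↭R)) (interval-unique (suc s) (suc m)))
    , precedes-insertions s o)
    where
    step : ∀ {o′} → (∀ v → productℕ o′ v ≡ attachSwap (precedes o′ s (suc s)) s (productℕ o) v) ×
                    (∀ {a b} → a ≢ s → b ≢ s → precedes o′ a b ≡ precedes o a b) →
           ∀ v → productℕ o′ v ≡ zigzag s (patternOf (s ∷ R) o′) v
    step {o′} (o′≗ , same) v = begin
      productℕ o′ v                                                        ≡⟨ o′≗ v ⟩
      attachSwap (precedes o′ s (suc s)) s (productℕ o) v
        ≡⟨ attachSwap-cong (precedes o′ s (suc s)) s o≗ v ⟩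
      attachSwap (precedes o′ s (suc s)) s (zigzag (suc s) (patternOf R o)) v
        ≡⟨ cong (λ P → attachSwap (precedes o′ s (suc s)) s (zigzag (suc s) P) v) (sym (patternOf-insertion R R≢s same)) ⟩
      zigzag s (patternOf (s ∷ R) o′) v                                    ∎
      where open ≡-Reasoning

sum-map-++ : ∀ {A : Set} (f : A → ℕ) xs ys → sum (map f (xs ++ ys)) ≡ sum (map f xs) + sum (map f ys)
sum-map-++ f xs ys = trans (cong sum (map-++ f xs ys)) (sum-++ (map f xs) (map f ys))

sum-map-concatMap : ∀ {A B : Set} (f : B → ℕ) (g : A → List B) xs →
                    sum (map f (concatMap g xs)) ≡ sum (map (λ x → sum (map f (g x))) xs)
sum-map-concatMap f g []       = refl
sum-map-concatMap f g (x ∷ xs) =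
  trans (sum-map-++ f (g x) (concatMap g xs)) (cong (sum (map f (g x)) +_) (sum-map-concatMap f g xs))

sum-map-∘ : ∀ {A B : Set} (f : B → ℕ) (g : A → B) xs → sum (map f (map g xs)) ≡ sum (map (f ∘ g) xs)
sum-map-∘ f g xs = cong sum (sym (map-∘ xs))

sum-map-cong : ∀ {A : Set} {f g : A → ℕ} {xs} → All (λ x → f x ≡ g x) xs → sum (map f xs) ≡ sum (map g xs)
sum-map-cong f≡g = cong sum (map-cong-local f≡g)

sum-map-zero : ∀ {A : Set} (xs : List A) → sum (map (const 0) xs) ≡ 0
sum-map-zero []       = refl
sum-map-zero (_ ∷ xs) = sum-map-zero xs

sum-map-if : ∀ {A : Set} c (f : A → ℕ) xs → sum (map (λ x → if c then f x else 0) xs) ≡ (if c then sum (map f xs) else 0)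
sum-map-if true  f xs = refl
sum-map-if false f xs = sum-map-zero xs

position : ℕ → List ℕ → ℕ
position a []      = 0
position a (z ∷ o) = if does (z ≟ a) then 0 else suc (position a o)

position-here : ∀ a o → position a (a ∷ o) ≡ 0
position-here a o rewrite dec-true (a ≟ a) refl = refl

position-skip : ∀ {a z} o → z ≢ a → position a (z ∷ o) ≡ suc (position a o)
position-skip {a} {z} o z≢a rewrite dec-false (z ≟ a) z≢a = refl

prefixSum : (ℕ → ℕ) → ℕ → ℕ
prefixSum w zero    = w 0
prefixSum w (suc p) = w 0 + prefixSum (w ∘ suc) p

-- suffixSum w L p = w (p + 1) + ⋯ + w L
suffixSum : (ℕ → ℕ) → ℕ → ℕ → ℕ
suffixSum w zero    p       = 0
suffixSum w (suc L) zero    = prefixSum (w ∘ suc) L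
suffixSum w (suc L) (suc p) = suffixSum (w ∘ suc) L p

shiftWeight : Bool → ℕ → (ℕ → ℕ) → ℕ → ℕ
shiftWeight true  L w = prefixSum w
shiftWeight false L w = suffixSum w L

-- The sum of w (position of x₀) over the orderings of x₀ x₁ … xₘ with pattern P (weightedCount-perms):
-- x₀ precedes x₁ iff it is inserted into an ordering of x₁ … xₘ at or before the position of x₁.
weightedCount : List Bool → (ℕ → ℕ) → ℕ
weightedCount []      w = w 0
weightedCount (b ∷ P) w = weightedCount P (shiftWeight b (suc (length P)) w)

insertions-position-sum : ∀ {x} o w → x ∉ o →
  sum (map (λ o′ → w (position x o′)) (insertions x o)) ≡ prefixSum w (length o)
insertions-position-sum {x} [] w _ = trans (cong (λ p → w p + 0) (position-here x [])) (+-identityʳ (w 0))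
insertions-position-sum {x} (y ∷ ys) w x∉y∷ys = cong₂ _+_
  (cong w (position-here x (y ∷ ys)))
  (trans (sum-map-∘ (λ o′ → w (position x o′)) (y ∷_) (insertions x ys))
  (trans (cong sum (map-cong (λ o′ → cong w (position-skip o′ (λ y≡x → x∉y∷ys (here (sym y≡x))))) (insertions x ys)))
         (insertions-position-sum ys (w ∘ suc) (x∉y∷ys ∘ there))))

shiftWeight-head : ∀ b L w → (if does (true Bool.≟ b) then w 0 else 0) +
                             (if does (false Bool.≟ b) then prefixSum (w ∘ suc) L else 0)
                             ≡ shiftWeight b (suc L) w 0
shiftWeight-head true  L w = +-identityʳ (w 0)
shiftWeight-head false L w = refl

shiftWeight-suc : ∀ b L w p → (if does (true Bool.≟ b) then w 0 else 0) + shiftWeight b L (w ∘ suc) p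
                              ≡ shiftWeight b (suc L) w (suc p)
shiftWeight-suc true  L w p = refl
shiftWeight-suc false L w p = refl

insertions-precedes-sum : ∀ b {x x₁} o w → x ∉ o → x₁ ∈ o →
  sum (map (λ o′ → if does (precedes o′ x x₁ Bool.≟ b) then w (position x o′) else 0) (insertions x o))
  ≡ shiftWeight b (length o) w (position x₁ o)
insertions-precedes-sum b {x} {x₁} (y ∷ ys) w x∉o x₁∈o = begin
  F (x ∷ y ∷ ys) + sum (map F (map (y ∷_) (insertions x ys)))
    ≡⟨ cong₂ _+_ first (sum-map-∘ F (y ∷_) (insertions x ys)) ⟩
  (if does (true Bool.≟ b) then w 0 else 0) + sum (map (F ∘ (y ∷_)) (insertions x ys))
    ≡⟨ behind (y ≟ x₁) x₁∈o ⟩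
  shiftWeight b (length (y ∷ ys)) w (position x₁ (y ∷ ys)) ∎
  where
  open ≡-Reasoning
  F : List ℕ → ℕ
  F o′ = if does (precedes o′ x x₁ Bool.≟ b) then w (position x o′) else 0
  y≢x : y ≢ x
  y≢x y≡x = x∉o (here (sym y≡x))
  first : F (x ∷ y ∷ ys) ≡ (if does (true Bool.≟ b) then w 0 else 0)
  first rewrite precedes-here x x₁ (y ∷ ys) | position-here x (y ∷ ys) = refl
  behind : Dec (y ≡ x₁) → x₁ ∈ y ∷ ys →
           (if does (true Bool.≟ b) then w 0 else 0) + sum (map (F ∘ (y ∷_)) (insertions x ys))
           ≡ shiftWeight b (length (y ∷ ys)) w (position x₁ (y ∷ ys))
  behind (yes refl) _ = begin
    _ ≡⟨ cong (_ +_) (trans (cong sum (map-cong (λ o′ → cong₂ (λ c p → if does (c Bool.≟ b) then w p else 0)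
                                                              (precedes-blocked o′ y≢x) (position-skip o′ y≢x))
                                                 (insertions x ys)))
                       (trans (sum-map-if (does (false Bool.≟ b)) (λ o′ → w (suc (position x o′))) (insertions x ys))
                              (cong (λ t → if does (false Bool.≟ b) then t else 0)
                                    (insertions-position-sum ys (w ∘ suc) (x∉o ∘ there))))) ⟩
    _ ≡⟨ shiftWeight-head b (length ys) w ⟩
    shiftWeight b (suc (length ys)) w 0 ≡⟨ cong (shiftWeight b (suc (length ys)) w) (sym (position-here y ys)) ⟩
    _ ∎
  behind (no y≢x₁) (here x₁≡y) = ⊥-elim (y≢x₁ (sym x₁≡y))
  behind (no y≢x₁) (there x₁∈ys) = begin
    _ ≡⟨ cong (_ +_) (trans (cong sum (map-cong (λ o′ → cong₂ (λ c p → if does (c Bool.≟ b) then w p else 0)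
                                                              (precedes-skip o′ y≢x y≢x₁) (position-skip o′ y≢x))
                                                 (insertions x ys)))
                       (insertions-precedes-sum b ys (w ∘ suc) (x∉o ∘ there) x₁∈ys)) ⟩
    _ ≡⟨ shiftWeight-suc b (length ys) w (position x₁ ys) ⟩
    _ ≡⟨ cong (shiftWeight b (suc (length ys)) w) (sym (position-skip ys y≢x₁)) ⟩
    _ ∎

_≟ᴾ_ : (P Q : List Bool) → Dec (P ≡ Q)
_≟ᴾ_ = ≡-dec Bool._≟_

patternWeight : ℕ → List ℕ → List Bool → (ℕ → ℕ) → List ℕ → ℕ
patternWeight x xs P w o = if does (patternOf (x ∷ xs) o ≟ᴾ P) then w (position x o) else 0

if-∧ : ∀ c d (u : ℕ) → (if c ∧ d then u else 0) ≡ (if d then (if c then u else 0) else 0)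
if-∧ true  d     u = refl
if-∧ false true  u = refl
if-∧ false false u = refl

insertions-patternWeight : ∀ b {x x₁ xs o} P w → x ∉ x₁ ∷ xs → o ↭ x₁ ∷ xs → length P ≡ length xs →
  sum (map (patternWeight x (x₁ ∷ xs) (b ∷ P) w) (insertions x o))
  ≡ patternWeight x₁ xs P (shiftWeight b (suc (length P)) w) o
insertions-patternWeight b {x} {x₁} {xs} {o} P w x∉ o↭ |P|≡|xs| = begin
  sum (map (patternWeight x (x₁ ∷ xs) (b ∷ P) w) (insertions x o))
    ≡⟨ sum-map-cong (All.map (λ {o′} → splitHead {o′}) (precedes-insertions x o)) ⟩
  sum (map (λ o′ → if matches then (if does (precedes o′ x x₁ Bool.≟ b) then w (position x o′) else 0) else 0)
           (insertions x o))
    ≡⟨ sum-map-if matches _ (insertions x o) ⟩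
  (if matches then sum (map (λ o′ → if does (precedes o′ x x₁ Bool.≟ b) then w (position x o′) else 0) (insertions x o))
              else 0)
    ≡⟨ cong (λ t → if matches then t else 0)
            (insertions-precedes-sum b o w (x∉ ∘ ∈-resp-↭ o↭) (∈-resp-↭ (↭.↭-sym o↭) (here refl))) ⟩
  (if matches then shiftWeight b (length o) w (position x₁ o) else 0)
    ≡⟨ cong (λ L → if matches then shiftWeight b L w (position x₁ o) else 0)
            (trans (↭-length o↭) (cong suc (sym |P|≡|xs|))) ⟩
  patternWeight x₁ xs P (shiftWeight b (suc (length P)) w) o ∎
  where
  open ≡-Reasoning
  matches = does (patternOf (x₁ ∷ xs) o ≟ᴾ P)
  x≢ : All (_≢ x) (x₁ ∷ xs)
  x≢ = All.tabulate (λ y∈ y≡x → x∉ (subst (_∈ x₁ ∷ xs) y≡x y∈))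
  splitHead : ∀ {o′} → (∀ {a c} → a ≢ x → c ≢ x → precedes o′ a c ≡ precedes o a c) →
    patternWeight x (x₁ ∷ xs) (b ∷ P) w o′ ≡
    (if matches then (if does (precedes o′ x x₁ Bool.≟ b) then w (position x o′) else 0) else 0)
  splitHead {o′} same =
    trans (cong (λ Q → if does (precedes o′ x x₁ Bool.≟ b) ∧ does (Q ≟ᴾ P) then w (position x o′) else 0)
                (patternOf-insertion (x₁ ∷ xs) x≢ same))
          (if-∧ (does (precedes o′ x x₁ Bool.≟ b)) matches (w (position x o′)))

weightedCount-perms : ∀ x xs → Unique (x ∷ xs) → ∀ P → length P ≡ length xs → ∀ w →
                      sum (map (patternWeight x xs P w) (perms (x ∷ xs))) ≡ weightedCount P w
weightedCount-perms x [] _ [] _ w = trans (cong (λ p → w p + 0) (position-here x [])) (+-identityʳ (w 0))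
weightedCount-perms x (x₁ ∷ xs) (x∉ ∷ unique) (b ∷ P) |P|≡|xs| w = begin
  sum (map (patternWeight x (x₁ ∷ xs) (b ∷ P) w) (perms (x ∷ x₁ ∷ xs)))
    ≡⟨ sum-map-concatMap _ (insertions x) (perms (x₁ ∷ xs)) ⟩
  sum (map (λ o → sum (map (patternWeight x (x₁ ∷ xs) (b ∷ P) w) (insertions x o))) (perms (x₁ ∷ xs)))
    ≡⟨ sum-map-cong (All.map (λ o↭ → insertions-patternWeight b P w (λ x∈ → All.lookup x∉ x∈ refl) o↭ |P|≡|xs|′)
                             (perms-↭ (x₁ ∷ xs))) ⟩
  sum (map (patternWeight x₁ xs P w′) (perms (x₁ ∷ xs)))
    ≡⟨ weightedCount-perms x₁ xs unique P |P|≡|xs|′ w′ ⟩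
  weightedCount P w′ ∎
  where
  open ≡-Reasoning
  w′ = shiftWeight b (suc (length P)) w
  |P|≡|xs|′ = suc-injective |P|≡|xs|

map-insertions : ∀ {A B : Set} (f : A → B) x xs → map (map f) (insertions x xs) ≡ insertions (f x) (map f xs)
map-insertions f x []       = refl
map-insertions f x (y ∷ ys) = cong ((f x ∷ f y ∷ map f ys) ∷_) (begin
  map (map f) (map (y ∷_) (insertions x ys)) ≡⟨ sym (map-∘ (insertions x ys)) ⟩
  map (λ o → f y ∷ map f o) (insertions x ys) ≡⟨ map-∘ (insertions x ys) ⟩
  map (f y ∷_) (map (map f) (insertions x ys)) ≡⟨ cong (map (f y ∷_)) (map-insertions f x ys) ⟩
  map (f y ∷_) (insertions (f x) (map f ys)) ∎)
  where open ≡-Reasoning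

map-perms : ∀ {A B : Set} (f : A → B) xs → map (map f) (perms xs) ≡ perms (map f xs)
map-perms f []       = refl
map-perms f (x ∷ xs) = begin
  map (map f) (concatMap (insertions x) (perms xs))           ≡⟨ map-concatMap (map f) (insertions x) (perms xs) ⟩
  concatMap (map (map f) ∘ insertions x) (perms xs)           ≡⟨ concatMap-cong (map-insertions f x) (perms xs) ⟩
  concatMap (insertions (f x) ∘ map f) (perms xs)             ≡⟨ sym (concatMap-map (insertions (f x)) (map f) (perms xs)) ⟩
  concatMap (insertions (f x)) (map (map f) (perms xs))       ≡⟨ cong (concatMap (insertions (f x))) (map-perms f xs) ⟩
  concatMap (insertions (f x)) (perms (map f xs))             ∎
  where open ≡-Reasoning

tabulate-interval : ∀ s n (f : Fin n → ℕ) → (∀ i → f i ≡ s + toℕ i) → tabulate f ≡ interval s n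
tabulate-interval s zero    f _   = refl
tabulate-interval s (suc n) f f≗ =
  cong₂ _∷_ (trans (f≗ Fin.zero) (+-identityʳ s))
            (tabulate-interval (suc s) n (f ∘ Fin.suc) (λ i → trans (f≗ (Fin.suc i)) (+-suc s (toℕ i))))

orderings-toℕ : ∀ n → map (map toℕ) (orderings n) ≡ perms (interval 0 n)
orderings-toℕ n = trans (map-perms toℕ (allFin n))
                        (cong perms (trans (map-tabulate id toℕ) (tabulate-interval 0 n toℕ (λ _ → refl))))

length-filter-sum : ∀ {A : Set} {P : A → Set} (P? : Decidable P) xs →
                    length (filter P? xs) ≡ sum (map (λ x → if does (P? x) then 1 else 0) xs)
length-filter-sum P? []       = refl
length-filter-sum P? (x ∷ xs) with does (P? x)
... | true  = cong suc (length-filter-sum P? xs)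
... | false = length-filter-sum P? xs

filter-nonempty : ∀ {A : Set} {P : A → Set} (P? : Decidable P) xs → 1 ≤ length (filter P? xs) →
                  ∃ λ x → x ∈ xs × P x
filter-nonempty P? (x ∷ xs) 1≤ with P? x
... | yes px = x , here refl , px
... | no  _  with filter-nonempty P? xs 1≤
...   | y , y∈xs , py = y , there y∈xs , py

IsZigzag : ∀ {n} → (Fin (suc n) → Fin (suc n)) → List Bool → Set
IsZigzag σ P = ∀ k → toℕ (σ k) ≡ zigzag 0 P (toℕ k)

Matches : ∀ {n} → (Fin (suc n) → Fin (suc n)) → List ℕ → Set
Matches σ l = ∀ k → productℕ l (toℕ k) ≡ toℕ (σ k)

matches? : ∀ {n} (σ : Fin (suc n) → Fin (suc n)) l → Dec (Matches σ l)
matches? σ l = all? (λ k → productℕ l (toℕ k) ≟ toℕ (σ k))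

multiplicity-perms : ∀ n σ → multiplicity n σ ≡ sum (map (λ l → if does (matches? σ l) then 1 else 0) (perms (interval 0 n)))
multiplicity-perms n σ = begin
  length (filter (λ o → all? (λ k → product o k Fin.≟ σ k)) (orderings n))
    ≡⟨ length-filter-sum _ (orderings n) ⟩
  sum (map (λ o → if does (all? (λ k → product o k Fin.≟ σ k)) then 1 else 0) (orderings n))
    ≡⟨ cong sum (map-cong (λ o → cong (λ b → if b then 1 else 0)
                                      (does-⇔ (matching o) (all? (λ k → product o k Fin.≟ σ k)) (matches? σ (map toℕ o))))
                          (orderings n)) ⟩
  sum (map (λ o → if does (matches? σ (map toℕ o)) then 1 else 0) (orderings n))
    ≡⟨ sym (sum-map-∘ _ (map toℕ) (orderings n)) ⟩
  sum (map (λ l → if does (matches? σ l) then 1 else 0) (map (map toℕ) (orderings n)))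
    ≡⟨ cong (λ ls → sum (map (λ l → if does (matches? σ l) then 1 else 0) ls)) (orderings-toℕ n) ⟩
  sum (map (λ l → if does (matches? σ l) then 1 else 0) (perms (interval 0 n))) ∎
  where
  open ≡-Reasoning
  matching : ∀ o → (∀ k → product o k ≡ σ k) ⇔ Matches σ (map toℕ o)
  matching o = mk⇔ (λ o≗σ k → trans (sym (toℕ-product o k)) (cong toℕ (o≗σ k)))
                   (λ o≗σ k → toℕ-injective (trans (toℕ-product o k) (o≗σ k)))

matches⇔pattern : ∀ m (σ : Fin (2 + m) → Fin (2 + m)) P l → length P ≡ m → IsZigzag σ P →
                  (∀ v → productℕ l v ≡ zigzag 0 (patternOf (interval 0 (suc m)) l) v) →
                  Matches σ l ⇔ patternOf (interval 0 (suc m)) l ≡ P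
matches⇔pattern m σ P l |P|≡m σ≗P l≗ = mk⇔
  (λ l≗σ → zigzag-injective (patternOf I l) P (trans |pattern|≡m (sym |P|≡m)) (s≤s (≤-reflexive |pattern|≡m))
             (λ v v≤ → subst (λ u → zigzag 0 (patternOf I l) u ≡ zigzag 0 P u) (toℕ-fromℕ< (s≤s v≤))
                             (trans (sym (l≗ _)) (trans (l≗σ (fromℕ< (s≤s v≤))) (σ≗P (fromℕ< (s≤s v≤)))))))
  (λ pattern≡P k → trans (l≗ (toℕ k)) (trans (cong (λ Q → zigzag 0 Q (toℕ k)) pattern≡P) (sym (σ≗P k))))
  where
  I = interval 0 (suc m)
  |pattern|≡m : length (patternOf I l) ≡ m
  |pattern|≡m = trans (length-patternOf 0 (interval 1 m) l) (length-interval 1 m)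

multiplicity-zigzag : ∀ m (σ : Fin (2 + m) → Fin (2 + m)) P → length P ≡ m → IsZigzag σ P →
                      multiplicity (suc m) σ ≡ weightedCount P (const 1)
multiplicity-zigzag m σ P |P|≡m σ≗P = begin
  multiplicity (suc m) σ
    ≡⟨ multiplicity-perms (suc m) σ ⟩
  sum (map (λ l → if does (matches? σ l) then 1 else 0) (perms (interval 0 (suc m))))
    ≡⟨ sum-map-cong (All.map indicator (productℕ-zigzag 0 m)) ⟩
  sum (map (patternWeight 0 (interval 1 m) P (const 1)) (perms (interval 0 (suc m))))
    ≡⟨ weightedCount-perms 0 (interval 1 m) (interval-unique 0 (suc m)) P
                           (trans |P|≡m (sym (length-interval 1 m))) (const 1) ⟩
  weightedCount P (const 1) ∎
  where
  open ≡-Reasoning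
  indicator : ∀ {l} → (∀ v → productℕ l v ≡ zigzag 0 (patternOf (interval 0 (suc m)) l) v) →
              (if does (matches? σ l) then 1 else 0) ≡ patternWeight 0 (interval 1 m) P (const 1) l
  indicator {l} l≗ = cong (λ b → if b then 1 else 0)
    (does-⇔ (matches⇔pattern m σ P l |P|≡m σ≗P l≗) (matches? σ l) (patternOf (interval 0 (suc m)) l ≟ᴾ P))

realised-isZigzag : ∀ m (σ : Fin (2 + m) → Fin (2 + m)) → 1 ≤ multiplicity (suc m) σ →
                    ∃ λ P → length P ≡ m × IsZigzag σ P
realised-isZigzag m σ 1≤ with filter-nonempty (λ o → all? (λ k → product o k Fin.≟ σ k)) (orderings (suc m)) 1≤
... | o , o∈ , o≗σ =
  patternOf I l , trans (length-patternOf 0 (interval 1 m) l) (length-interval 1 m) ,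
  λ k → trans (cong toℕ (sym (o≗σ k))) (trans (toℕ-product o k) (All.lookup (productℕ-zigzag 0 m) l∈ (toℕ k)))
  where
  I = interval 0 (suc m)
  l = map toℕ o
  l∈ : l ∈ perms I
  l∈ = subst (l ∈_) (orderings-toℕ (suc m)) (∈-map⁺ (map toℕ) o∈)

prefixSum-≥ : ∀ w {q} p → q ≤ p → w q ≤ prefixSum w p
prefixSum-≥ w {zero}  zero    _         = ≤-refl
prefixSum-≥ w {zero}  (suc p) _         = m≤m+n (w 0) _
prefixSum-≥ w {suc q} (suc p) (s≤s q≤p) = ≤-trans (prefixSum-≥ (w ∘ suc) p q≤p) (m≤n+m _ (w 0))

prefixSum-≥₂ : ∀ w {q r p} → q < r → r ≤ p → w q + w r ≤ prefixSum w p
prefixSum-≥₂ w {zero}  {suc r} {suc p} _         (s≤s r≤p) = +-monoʳ-≤ (w 0) (prefixSum-≥ (w ∘ suc) _ r≤p)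
prefixSum-≥₂ w {suc q} {suc r} {suc p} (s≤s q<r) (s≤s r≤p) =
  ≤-trans (prefixSum-≥₂ (w ∘ suc) q<r r≤p) (m≤n+m _ (w 0))

suffixSum-≥ : ∀ w {L p q} → p < q → q ≤ L → w q ≤ suffixSum w L p
suffixSum-≥ w {suc L} {zero}  {suc q} _         (s≤s q≤L) = prefixSum-≥ (w ∘ suc) _ q≤L
suffixSum-≥ w {suc L} {suc p} {suc q} (s≤s p<q) (s≤s q≤L) = suffixSum-≥ (w ∘ suc) p<q q≤L

suffixSum-≥₂ : ∀ w {L p q r} → p < q → q < r → r ≤ L → w q + w r ≤ suffixSum w L p
suffixSum-≥₂ w {suc L} {zero}  {suc q} {suc r} _         (s≤s q<r) (s≤s r≤L) = prefixSum-≥₂ (w ∘ suc) q<r r≤L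
suffixSum-≥₂ w {suc L} {suc p} {suc q} {suc r} (s≤s p<q) (s≤s q<r) (s≤s r≤L) = suffixSum-≥₂ (w ∘ suc) p<q q<r r≤L

suffixSum-last : ∀ w k → suffixSum w (suc k) k ≡ w (suc k)
suffixSum-last w zero    = refl
suffixSum-last w (suc k) = suffixSum-last (w ∘ suc) k

suffixSum-last₂ : ∀ w k → suffixSum w (2 + k) k ≡ w (suc k) + w (2 + k)
suffixSum-last₂ w zero    = refl
suffixSum-last₂ w (suc k) = suffixSum-last₂ (w ∘ suc) k

prefixSum-const : ∀ p → prefixSum (const 1) p ≡ suc p
prefixSum-const zero    = refl
prefixSum-const (suc p) = cong suc (prefixSum-const p)

suffixSum-const : ∀ N q → q ≤ N → suffixSum (const 1) N q + q ≡ N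
suffixSum-const zero    zero    _         = refl
suffixSum-const (suc N) zero    _         = trans (+-identityʳ _) (prefixSum-const N)
suffixSum-const (suc N) (suc q) (s≤s q≤N) = trans (+-suc _ q) (cong suc (suffixSum-const N q q≤N))

weightedCount-≥ : ∀ P w {a} → (∀ p → p ≤ length P → a ≤ w p) → a ≤ weightedCount P w
weightedCount-≥ []          w a≤w = a≤w 0 z≤n
weightedCount-≥ (true ∷ P)  w a≤w =
  weightedCount-≥ P (prefixSum w) (λ p _ → ≤-trans (a≤w 0 z≤n) (prefixSum-≥ w p z≤n))
weightedCount-≥ (false ∷ P) w a≤w = weightedCount-≥ P (suffixSum w (suc (length P)))
  (λ p p≤ → ≤-trans (a≤w (suc (length P)) ≤-refl) (suffixSum-≥ w (s≤s p≤) ≤-refl))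

weightedCount-trues : ∀ k w → weightedCount (replicate k true) w ≡ w 0
weightedCount-trues zero    w = refl
weightedCount-trues (suc k) w = weightedCount-trues k (prefixSum w)

weightedCount-falses : ∀ k w → weightedCount (replicate k false) w ≡ w k
weightedCount-falses zero    w = refl
weightedCount-falses (suc k) w rewrite length-replicate k {false} =
  trans (weightedCount-falses k (suffixSum w (suc k))) (suffixSum-last w k)

weightedCount-trues-false : ∀ k w → weightedCount (replicate k true ++ [ false ]) w ≡ k * w 0 + w 1
weightedCount-trues-false zero    w = refl
weightedCount-trues-false (suc k) w =
  trans (weightedCount-trues-false k (prefixSum w))
        (trans (sym (+-assoc (k * w 0) (w 0) (w 1))) (cong (_+ w 1) (+-comm (k * w 0) (w 0))))

length-replicate-snoc : ∀ k (b c : Bool) → length (replicate k b ++ [ c ]) ≡ suc k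
length-replicate-snoc k b c = trans (length-++ (replicate k b)) (trans (+-comm _ 1) (cong suc (length-replicate k)))

weightedCount-falses-true : ∀ k w → weightedCount (replicate k false ++ [ true ]) w ≡ w k + k * w (suc k)
weightedCount-falses-true zero    w = sym (+-identityʳ (w 0))
weightedCount-falses-true (suc k) w rewrite length-replicate-snoc k false true =
  trans (weightedCount-falses-true k (suffixSum w (2 + k)))
        (trans (cong₂ _+_ (suffixSum-last₂ w k) (cong (k *_) (suffixSum-last w (suc k))))
               (+-assoc (w (suc k)) (w (2 + k)) (k * w (2 + k))))

data RunOrLarge (b : Bool) (Q : List Bool) (bound count : ℕ) : Set where
  run       : Q ≡ replicate (length Q) b → RunOrLarge b Q bound count
  runSwitch : ∀ i → Q ≡ replicate i b ++ [ not b ] → RunOrLarge b Q bound count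
  large     : bound < count → RunOrLarge b Q bound count

runOrLarge-∷ : ∀ {b Q L c count} → RunOrLarge b Q (L + suc c) count → RunOrLarge b (b ∷ Q) (suc L + c) count
runOrLarge-∷ {b} (run Q≡)         = run (cong (b ∷_) Q≡)
runOrLarge-∷ {b} (runSwitch i Q≡) = runSwitch (suc i) (cong (b ∷_) Q≡)
runOrLarge-∷ {L = L} {c} {count} (large <count) = large (subst (_< count) (+-suc L c) <count)

trues-runOrLarge : ∀ Q w c → 1 ≤ w 0 → (∀ p → 2 ≤ p → p ≤ length Q → suc (p + c) ≤ w p) →
                   RunOrLarge true Q (length Q + c) (weightedCount Q w)
trues-runOrLarge []          w c _    _     = run refl
trues-runOrLarge (true ∷ Q)  w c 1≤w0 w-big = runOrLarge-∷ (trues-runOrLarge Q (prefixSum w) (suc c) 1≤w0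
  (λ p 2≤p p≤ → ≤-trans (≤-reflexive (cong suc (+-suc p c)))
                        (≤-trans (+-mono-≤ 1≤w0 (w-big p 2≤p (m≤n⇒m≤1+n p≤)))
                                 (prefixSum-≥₂ w {0} {p} (≤-trans (s≤s z≤n) 2≤p) ≤-refl))))
trues-runOrLarge (false ∷ [])    w c _ _     = runSwitch 0 refl
trues-runOrLarge (false ∷ d ∷ Q) w c _ w-big = large (weightedCount-≥ (d ∷ Q) (suffixSum w L)
  (λ p p≤ → ≤-trans (w-big L (s≤s (s≤s z≤n)) ≤-refl) (suffixSum-≥ w (s≤s p≤) ≤-refl)))
  where L = suc (length (d ∷ Q))

falses-runOrLarge : ∀ Q w c → 1 ≤ w (length Q) → (∀ p → 2 + p ≤ length Q → suc (length Q + c) ≤ w p + p) →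
                    RunOrLarge false Q (length Q + c) (weightedCount Q w)
falses-runOrLarge []          w c _     _     = run refl
falses-runOrLarge (false ∷ Q) w c 1≤wL w-big = runOrLarge-∷ (falses-runOrLarge Q w′ (suc c)
  (subst (1 ≤_) (sym (suffixSum-last w (length Q))) 1≤wL)
  (λ p 2+p≤ → begin
    suc (length Q + suc c)           ≡⟨ cong suc (+-suc (length Q) c) ⟩
    suc (suc (length Q) + c)         ≤⟨ w-big (suc p) (s≤s 2+p≤) ⟩
    w (suc p) + suc p                ≡⟨ +-suc (w (suc p)) p ⟩
    suc (w (suc p)) + p              ≡⟨ cong (_+ p) (+-comm 1 (w (suc p))) ⟩
    w (suc p) + 1 + p                ≤⟨ +-monoˡ-≤ p (+-monoʳ-≤ (w (suc p)) 1≤wL) ⟩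
    w (suc p) + w (suc (length Q)) + p
      ≤⟨ +-monoˡ-≤ p (suffixSum-≥₂ w ≤-refl (s≤s (≤-trans (n≤1+n _) 2+p≤)) ≤-refl) ⟩
    w′ p + p                         ∎))
  where
  open ≤-Reasoning
  w′ = suffixSum w (suc (length Q))
falses-runOrLarge (true ∷ [])    w c _ _     = runSwitch 0 refl
falses-runOrLarge (true ∷ d ∷ Q) w c _ w-big = large (weightedCount-≥ (d ∷ Q) (prefixSum w)
  (λ p _ → ≤-trans (subst (suc (L + c) ≤_) (+-identityʳ (w 0)) (w-big 0 (s≤s (s≤s z≤n)))) (prefixSum-≥ w p z≤n)))
  where L = suc (length (d ∷ Q))

falses-or-large : ∀ Q w a → (∀ p → p ≤ length Q → a ≤ w p) → (∀ p → p < length Q → suc a ≤ w p) →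
                  Q ≡ replicate (length Q) false ⊎ a < weightedCount Q w
falses-or-large []          w a _   _   = inj₁ refl
falses-or-large (false ∷ Q) w a a≤w a<w
  with falses-or-large Q (suffixSum w (suc (length Q))) a
         (λ p p≤ → ≤-trans (a≤w (suc (length Q)) ≤-refl) (suffixSum-≥ w (s≤s p≤) ≤-refl))
         (λ p p< → ≤-trans (a<w (suc p) (s≤s p<)) (suffixSum-≥ w ≤-refl (m≤n⇒m≤1+n p<)))
... | inj₁ Q≡ = inj₁ (cong (false ∷_) Q≡)
... | inj₂ a< = inj₂ a<
falses-or-large (true ∷ Q)  w a _   a<w =
  inj₂ (weightedCount-≥ Q (prefixSum w) (λ p _ → ≤-trans (a<w 0 (s≤s z≤n)) (prefixSum-≥ w p z≤n)))

trues-or-large : ∀ Q w a → (∀ p → p ≤ length Q → a ≤ w p) → (∀ p → 1 ≤ p → p ≤ length Q → suc a ≤ w p) →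
                 Q ≡ replicate (length Q) true ⊎ a < weightedCount Q w
trues-or-large []          w a _   _   = inj₁ refl
trues-or-large (true ∷ Q)  w a a≤w a<w
  with trues-or-large Q (prefixSum w) a
         (λ p _ → ≤-trans (a≤w 0 z≤n) (prefixSum-≥ w p z≤n))
         (λ p 1≤p p≤ → ≤-trans (a<w p 1≤p (m≤n⇒m≤1+n p≤)) (prefixSum-≥ w p ≤-refl))
... | inj₁ Q≡ = inj₁ (cong (true ∷_) Q≡)
... | inj₂ a< = inj₂ a<
trues-or-large (false ∷ Q) w a _   a<w = inj₂ (weightedCount-≥ Q (suffixSum w (suc (length Q)))
  (λ p p≤ → ≤-trans (a<w (suc (length Q)) (s≤s z≤n) ≤-refl) (suffixSum-≥ w (s≤s p≤) ≤-refl)))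

falseFalse-weight : ∀ L p → 2 + p ≤ L →
                    suc (L + 2) ≤ suffixSum (suffixSum (const 1) (2 + L)) (suc L) p + p
falseFalse-weight L p 2+p≤L = begin
  suc (L + 2)                 ≡⟨ cong suc (trans (+-comm L 2) (sym (suffixSum-const (2 + L) (suc p) 1+p≤))) ⟩
  suc (w₁ (suc p) + suc p)    ≡⟨ sym (trans (+-assoc (w₁ (suc p)) 2 p) (+-suc (w₁ (suc p)) (suc p))) ⟩
  w₁ (suc p) + 2 + p          ≤⟨ +-monoˡ-≤ p (+-monoʳ-≤ (w₁ (suc p)) 2≤w₁[2+p]) ⟩
  w₁ (suc p) + w₁ (2 + p) + p ≤⟨ +-monoˡ-≤ p (suffixSum-≥₂ w₁ ≤-refl ≤-refl (m≤n⇒m≤1+n 2+p≤L)) ⟩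
  suffixSum w₁ (suc L) p + p  ∎
  where
  open ≤-Reasoning
  w₁ = suffixSum (const 1) (2 + L)
  1+p≤ : suc p ≤ 2 + L
  1+p≤ = ≤-trans (n≤1+n _) (m≤n⇒m≤1+n (m≤n⇒m≤1+n 2+p≤L))
  2≤w₁[2+p] : 2 ≤ w₁ (2 + p)
  2≤w₁[2+p] = +-cancelʳ-≤ (2 + p) 2 (w₁ (2 + p))
    (≤-trans (+-monoʳ-≤ 2 2+p≤L) (≤-reflexive (sym (suffixSum-const (2 + L) (2 + p) (m≤n⇒m≤1+n (m≤n⇒m≤1+n 2+p≤L))))))

trueTrue-weight : ∀ p → 2 ≤ p → suc (p + 2) ≤ prefixSum (prefixSum (const 1)) p
trueTrue-weight p 2≤p = begin
  suc (p + 2)                                     ≡⟨ cong suc (+-comm p 2) ⟩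
  prefixSum (const 1) 1 + suc p                   ≡⟨ cong (2 +_) (sym (prefixSum-const p)) ⟩
  prefixSum (const 1) 1 + prefixSum (const 1) p   ≤⟨ prefixSum-≥₂ (prefixSum (const 1)) 2≤p ≤-refl ⟩
  prefixSum (prefixSum (const 1)) p               ∎
  where open ≤-Reasoning

falseFalse-weight-last : ∀ L → 1 ≤ suffixSum (suffixSum (const 1) (2 + L)) (suc L) L
falseFalse-weight-last L = ≤-reflexive (sym (trans (suffixSum-last _ L) (suffixSum-last (const 1) (suc L))))

trueFalse-weight : ∀ L p → p ≤ L → 2 + L ≤ suffixSum (prefixSum (const 1)) (suc L) p
trueFalse-weight L p p≤L =
  subst (_≤ suffixSum (prefixSum (const 1)) (suc L) p) (prefixSum-const (suc L))
        (suffixSum-≥ (prefixSum (const 1)) (s≤s p≤L) ≤-refl)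

trueFalse-weight-< : ∀ L p → p < L → 3 + L ≤ suffixSum (prefixSum (const 1)) (suc L) p
trueFalse-weight-< L p p<L = begin
  3 + L                                                   ≤⟨ s≤s (m≤n+m (2 + L) (suc p)) ⟩
  (2 + p) + (2 + L)                                       ≡⟨ sym (cong₂ _+_ (prefixSum-const (suc p)) (prefixSum-const (suc L))) ⟩
  prefixSum (const 1) (suc p) + prefixSum (const 1) (suc L) ≤⟨ suffixSum-≥₂ (prefixSum (const 1)) ≤-refl (s≤s p<L) ≤-refl ⟩
  suffixSum (prefixSum (const 1)) (suc L) p               ∎
  where open ≤-Reasoning

falseTrue-weight : ∀ L p → 2 + L ≤ prefixSum (suffixSum (const 1) (2 + L)) p
falseTrue-weight L p = ≤-trans (≤-reflexive (sym (prefixSum-const (suc L)))) (prefixSum-≥ (suffixSum (const 1) (2 + L)) p z≤n)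

falseTrue-weight-pos : ∀ L p → 1 ≤ p → p ≤ L → 3 + L ≤ prefixSum (suffixSum (const 1) (2 + L)) p
falseTrue-weight-pos L p 1≤p p≤L = begin
  3 + L                   ≡⟨ +-comm 1 (2 + L) ⟩
  2 + L + 1               ≡⟨ cong (_+ 1) (sym (prefixSum-const (suc L))) ⟩
  w₁ 0 + 1                ≤⟨ +-monoʳ-≤ (w₁ 0) (suffixSum-≥ (const 1) (s≤s (m≤n⇒m≤1+n p≤L)) ≤-refl) ⟩
  w₁ 0 + w₁ p             ≤⟨ prefixSum-≥₂ w₁ 1≤p ≤-refl ⟩
  prefixSum w₁ p          ∎
  where
  open ≤-Reasoning
  w₁ = suffixSum (const 1) (2 + L)

data Exceptional (j : ℕ) : List Bool → Set where
  truesFalse : Exceptional j (replicate j true ++ [ false ])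
  falsesTrue : Exceptional j (replicate j false ++ [ true ])
  falseTrues : Exceptional j (false ∷ replicate j true)
  trueFalses : Exceptional j (true ∷ replicate j false)

data Classified (j : ℕ) : List Bool → Set where
  trues       : Classified j (replicate (suc j) true)
  falses      : Classified j (replicate (suc j) false)
  exceptional : ∀ {P} → Exceptional j P → Classified j P
  large       : ∀ {P} → suc j < weightedCount P (const 1) → Classified j P

classify-run : ∀ b i Q → length Q ≡ i → Classified (suc i) (replicate (2 + i) b) →
               (∀ {j} → Exceptional j (replicate j b ++ [ not b ])) →
               RunOrLarge b Q (length Q + 2) (weightedCount (b ∷ b ∷ Q) (const 1)) → Classified (suc i) (b ∷ b ∷ Q)
classify-run b i Q |Q|≡i constant _ (run Q≡) =
  subst (Classified (suc i)) (cong (λ Q → b ∷ b ∷ Q) (sym (trans Q≡ (cong (λ k → replicate k b) |Q|≡i)))) constant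
classify-run b i _ |Q|≡i _ switch (runSwitch k refl) =
  subst (λ i → Classified (suc i) _) (sym (trans (sym |Q|≡i) (length-replicate-snoc k b (not b)))) (exceptional switch)
classify-run b i Q |Q|≡i _ _ (large more) =
  large (subst (_< weightedCount (b ∷ b ∷ Q) (const 1)) (trans (+-comm (length Q) 2) (cong (2 +_) |Q|≡i)) more)

classify : ∀ i P → length P ≡ 2 + i → Classified (suc i) P
classify i (true ∷ true ∷ Q) |P|≡ = classify-run true i Q (suc-injective (suc-injective |P|≡)) trues truesFalse
  (trues-runOrLarge Q (prefixSum (prefixSum (const 1))) 2 (s≤s z≤n) (λ p 2≤p _ → trueTrue-weight p 2≤p))
classify i (false ∷ false ∷ Q) |P|≡ = classify-run false i Q (suc-injective (suc-injective |P|≡)) falses falsesTrue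
  (falses-runOrLarge Q (suffixSum (suffixSum (const 1) (2 + length Q)) (suc (length Q))) 2
                     (falseFalse-weight-last (length Q)) (falseFalse-weight (length Q)))
classify i (true ∷ false ∷ Q) refl
  with falses-or-large Q (suffixSum (prefixSum (const 1)) (suc (length Q))) (2 + length Q)
                       (trueFalse-weight (length Q)) (trueFalse-weight-< (length Q))
... | inj₁ Q≡  = subst (Classified _) (cong (λ Q → true ∷ false ∷ Q) (sym Q≡)) (exceptional trueFalses)
... | inj₂ more = large more
classify i (false ∷ true ∷ Q) refl
  with trues-or-large Q (prefixSum (suffixSum (const 1) (2 + length Q))) (2 + length Q)
                      (λ p _ → falseTrue-weight (length Q) p) (falseTrue-weight-pos (length Q))
... | inj₁ Q≡  = subst (Classified _) (cong (λ Q → false ∷ true ∷ Q) (sym Q≡)) (exceptional falseTrues)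
... | inj₂ more = large more

cycleℕ-head : ∀ a b r → cycleℕ (a ∷ b ∷ r) a ≡ b
cycleℕ-head a b r rewrite dec-true (a ≟ a) refl = refl

cycleℕ-single : ∀ a → cycleℕ (a ∷ []) a ≡ a
cycleℕ-single a rewrite dec-true (a ≟ a) refl = refl

cycleℕ-skip : ∀ {a b k} r → k ≢ a → k ≢ b → cycleℕ (a ∷ b ∷ r) k ≡ cycleℕ (a ∷ r) k
cycleℕ-skip {a} {b} {k} []      k≢a k≢b rewrite dec-false (k ≟ a) k≢a | dec-false (k ≟ b) k≢b = refl
cycleℕ-skip {a} {b} {k} (c ∷ r) k≢a k≢b rewrite dec-false (k ≟ a) k≢a | dec-false (k ≟ b) k≢b = refl

cycleℕ-next : ∀ {a k} c r → k ≢ a → cycleℕ (a ∷ k ∷ c ∷ r) k ≡ c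
cycleℕ-next {a} {k} c r k≢a rewrite dec-false (k ≟ a) k≢a | dec-true (k ≟ k) refl = refl

cycleℕ-last : ∀ {a k} → k ≢ a → cycleℕ (a ∷ k ∷ []) k ≡ a
cycleℕ-last {a} {k} k≢a rewrite dec-false (k ≟ a) k≢a | dec-true (k ≟ k) refl = refl

MapsAlong : (ℕ → ℕ) → List ℕ → ℕ → Set
MapsAlong τ []          a = ⊥
MapsAlong τ (x ∷ [])    a = τ x ≡ a
MapsAlong τ (x ∷ y ∷ L) a = τ x ≡ y × MapsAlong τ (y ∷ L) a

cycleℕ-mapsAlong-tail : ∀ {τ a k} M → MapsAlong τ M a → k ≢ a → k ∈ M → cycleℕ (a ∷ M) k ≡ τ k
cycleℕ-mapsAlong-tail (x ∷ [])    τx≡a        k≢a (here refl) = trans (cycleℕ-last k≢a) (sym τx≡a)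
cycleℕ-mapsAlong-tail (x ∷ y ∷ L) (τx≡y , _) k≢a (here refl) = trans (cycleℕ-next y L k≢a) (sym τx≡y)
cycleℕ-mapsAlong-tail {k = k} (x ∷ y ∷ L) (τx≡y , maps) k≢a (there k∈) with k ≟ x
... | yes refl = trans (cycleℕ-next y L k≢a) (sym τx≡y)
... | no  k≢x  = trans (cycleℕ-skip (y ∷ L) k≢a k≢x) (cycleℕ-mapsAlong-tail (y ∷ L) maps k≢a k∈)

cycleℕ-mapsAlong : ∀ {τ a k} M → MapsAlong τ (a ∷ M) a → k ∈ a ∷ M → cycleℕ (a ∷ M) k ≡ τ k
cycleℕ-mapsAlong {a = a} {k} M maps k∈ with k ≟ a
cycleℕ-mapsAlong {a = a} [] τa≡a _ | yes refl = trans (cycleℕ-single a) (sym τa≡a)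
cycleℕ-mapsAlong {a = a} (b ∷ M) (τa≡b , _) _ | yes refl = trans (cycleℕ-head a b M) (sym τa≡b)
cycleℕ-mapsAlong M maps (here refl) | no k≢a = ⊥-elim (k≢a refl)
cycleℕ-mapsAlong (b ∷ M) (_ , maps) (there k∈) | no k≢a = cycleℕ-mapsAlong-tail (b ∷ M) maps k≢a k∈

mapsAlong-interval : ∀ {τ a} s j t → (∀ i → i < j → τ (s + i) ≡ suc (s + i)) →
                     MapsAlong τ ((s + j) ∷ t) a → MapsAlong τ (interval s (suc j) ++ t) a
mapsAlong-interval {τ} {a} s zero    t _    maps = subst (λ x → MapsAlong τ (x ∷ t) a) (+-identityʳ s) maps
mapsAlong-interval {τ} {a} s (suc j) t step maps =
  subst (λ x → τ x ≡ suc x) (+-identityʳ s) (step 0 (s≤s z≤n)) ,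
  mapsAlong-interval (suc s) j t (λ i i<j → subst (λ x → τ x ≡ suc x) (+-suc s i) (step (suc i) (s≤s i<j)))
                     (subst (λ x → MapsAlong τ (x ∷ t) a) (+-suc s j) maps)

mapsAlong-snoc : ∀ {τ x} L → MapsAlong τ L x → MapsAlong τ (L ++ [ x ]) (τ x)
mapsAlong-snoc (y ∷ [])    τy≡x          = τy≡x , refl
mapsAlong-snoc (y ∷ z ∷ L) (τy≡z , maps) = τy≡z , mapsAlong-snoc (z ∷ L) maps

mapsAlong-reverse : ∀ {τ τ′ a} → (∀ v → τ′ (τ v) ≡ v) → ∀ b L → MapsAlong τ (b ∷ L) a →
                    MapsAlong τ′ (reverse (b ∷ L)) (τ′ b)
mapsAlong-reverse           inverse b []      _             = refl
mapsAlong-reverse {τ′ = τ′} inverse b (c ∷ L) (τb≡c , maps) =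
  subst (λ L′ → MapsAlong τ′ L′ (τ′ b)) (sym (unfold-reverse b (c ∷ L)))
    (mapsAlong-snoc (reverse (c ∷ L))
      (subst (MapsAlong τ′ (reverse (c ∷ L))) (trans (cong τ′ (sym τb≡c)) (inverse b))
        (mapsAlong-reverse inverse c L maps)))

mapsAlong-last : ∀ {τ a z} L → MapsAlong τ (L ++ [ z ]) a → τ z ≡ a
mapsAlong-last []          τz≡a       = τz≡a
mapsAlong-last (x ∷ [])    (_ , maps) = maps
mapsAlong-last (x ∷ y ∷ L) (_ , maps) = mapsAlong-last (y ∷ L) maps

-- Vertex v carries label v + 1; fixing the unused label 0 makes onLabels preserve inverses.
onLabels : (ℕ → ℕ) → ℕ → ℕ
onLabels f zero    = zero
onLabels f (suc v) = suc (f v)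

onLabels-inverse : ∀ {f g} → (∀ v → g (f v) ≡ v) → ∀ v → onLabels g (onLabels f v) ≡ v
onLabels-inverse g∘f≗id zero    = refl
onLabels-inverse g∘f≗id (suc v) = cong suc (g∘f≗id v)

reverse-snoc-cons : ∀ (a : ℕ) M z → reverse (a ∷ M ++ [ z ]) ≡ z ∷ reverse (a ∷ M)
reverse-snoc-cons a M z = reverse-++ (a ∷ M) [ z ]

record LabelCycle (n : ℕ) (τ : ℕ → ℕ) (a : ℕ) (M : List ℕ) : Set where
  field
    mapsAlong : MapsAlong τ (a ∷ M) a
    covers    : ∀ v → v ≤ n → suc v ∈ a ∷ M

labelCycle-reverse : ∀ {n τ τ′ a z} M → (∀ v → τ′ (τ v) ≡ v) →
                     LabelCycle n τ a (M ++ [ z ]) → LabelCycle n τ′ z (reverse (a ∷ M))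
labelCycle-reverse {τ = τ} {τ′} {a} {z} M inverse cyc = record
  { mapsAlong = subst₂ (MapsAlong τ′) (reverse-snoc-cons a M z) τ′a≡z
                       (mapsAlong-reverse inverse a (M ++ [ z ]) (LabelCycle.mapsAlong cyc))
  ; covers    = λ v v≤n → subst (suc v ∈_) (reverse-snoc-cons a M z) (reverse⁺ (LabelCycle.covers cyc v v≤n))
  }
  where
  τ′a≡z : τ′ a ≡ z
  τ′a≡z = trans (cong τ′ (sym (mapsAlong-last (a ∷ M) (LabelCycle.mapsAlong cyc)))) (inverse z)

cycleUp : ℕ → ℕ → ℕ → ℕ
cycleUp s zero    u = u
cycleUp s (suc j) u = swapAdj s (cycleUp (suc s) j u)

cycleUp-below : ∀ {s u} j → u < s → cycleUp s j u ≡ u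
cycleUp-below zero    u<s = refl
cycleUp-below (suc j) u<s = trans (cong (swapAdj _) (cycleUp-below j (m<n⇒m<1+n u<s))) (swapAdj-below u<s)

cycleUp-step : ∀ {s u} j → s ≤ u → u < s + j → cycleUp s j u ≡ suc u
cycleUp-step {s} zero    s≤u u<s+0 = ⊥-elim (<-irrefl refl (<-≤-trans u<s+0 (≤-trans (≤-reflexive (+-identityʳ s)) s≤u)))
cycleUp-step {s} {u} (suc j) s≤u u<s+1+j with m≤n⇒m<n∨m≡n s≤u
... | inj₂ refl = trans (cong (swapAdj s) (cycleUp-below j (n<1+n s))) (swapAdj-here s)
... | inj₁ s<u  = trans (cong (swapAdj s) (cycleUp-step j s<u (subst (u <_) (+-suc s j) u<s+1+j)))
                        (swapAdj-above (s≤s s<u))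

cycleUp-top : ∀ s j → cycleUp s j (s + j) ≡ s
cycleUp-top s zero    = +-identityʳ s
cycleUp-top s (suc j) = trans (cong (swapAdj s ∘ cycleUp (suc s) j) (+-suc s j))
                              (trans (cong (swapAdj s) (cycleUp-top (suc s) j)) (swapAdj-there s))

cycleUp-above : ∀ {s u} j → s + j < u → cycleUp s j u ≡ u
cycleUp-above         zero    _       = refl
cycleUp-above {s} {u} (suc j) s+1+j<u =
  trans (cong (swapAdj s) (cycleUp-above j (subst (_< u) (+-suc s j) s+1+j<u)))
        (swapAdj-above (≤-trans (s≤s (s≤s (m≤m+n s j))) (subst (_< u) (+-suc s j) s+1+j<u)))

zigzag-trues : ∀ s j v → zigzag s (replicate j true) v ≡ cycleUp s (suc j) v
zigzag-trues s zero    v = refl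
zigzag-trues s (suc j) v = cong (swapAdj s) (zigzag-trues (suc s) j v)

zigzag-trues-++ : ∀ s j Q v → zigzag s (replicate j true ++ Q) v ≡ cycleUp s j (zigzag (s + j) Q v)
zigzag-trues-++ s zero    Q v = cong (λ x → zigzag x Q v) (sym (+-identityʳ s))
zigzag-trues-++ s (suc j) Q v = cong (swapAdj s)
  (trans (zigzag-trues-++ (suc s) j Q v) (cong (λ x → cycleUp (suc s) j (zigzag x Q v)) (sym (+-suc s j))))

zigzag-flip : ∀ s P v → zigzag s (map not P) (zigzag s P v) ≡ v
zigzag-flip s []          v = swapAdj-involutive s v
zigzag-flip s (true ∷ P)  v =
  trans (cong (zigzag (suc s) (map not P)) (swapAdj-involutive s (zigzag (suc s) P v))) (zigzag-flip (suc s) P v)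
zigzag-flip s (false ∷ P) v =
  trans (cong (swapAdj s) (zigzag-flip (suc s) P (swapAdj s v))) (swapAdj-involutive s v)

data CycleOfPattern (n : ℕ) (P : List Bool) : List ℕ → Set where
  cycleOfPattern : ∀ {a M} → LabelCycle n (onLabels (zigzag 0 P)) a M → CycleOfPattern n P (a ∷ M)

isCycle-zigzag : ∀ {n} (σ : Fin (suc n) → Fin (suc n)) {P L} → IsZigzag σ P → CycleOfPattern n P L → IsCycle n σ L
isCycle-zigzag σ σ≗P (cycleOfPattern {M = M} cyc) k =
  trans (cong suc (σ≗P k)) (sym (cycleℕ-mapsAlong M (LabelCycle.mapsAlong cyc) (LabelCycle.covers cyc (toℕ k) (toℕ≤pred[n] k))))

zigzag-isCycle : ∀ {n} (σ : Fin (suc n) → Fin (suc n)) {P L} → IsCycle n σ L → CycleOfPattern n P L → IsZigzag σ P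
zigzag-isCycle σ σ-cycle (cycleOfPattern {M = M} cyc) k = suc-injective
  (trans (σ-cycle k) (cycleℕ-mapsAlong M (LabelCycle.mapsAlong cyc) (LabelCycle.covers cyc (toℕ k) (toℕ≤pred[n] k))))

-- Flipping every bit reverses the orderings, hence inverts the product and reverses its cycle.
cycleOfPattern-flip : ∀ {n L a z} P M → L ≡ a ∷ M ++ [ z ] → LabelCycle n (onLabels (zigzag 0 P)) a (M ++ [ z ]) →
                      CycleOfPattern n (map not P) (reverse L)
cycleOfPattern-flip {a = a} {z} P M refl cyc =
  subst (CycleOfPattern _ (map not P)) (sym (reverse-snoc-cons a M z))
        (cycleOfPattern (labelCycle-reverse M (onLabels-inverse (zigzag-flip 0 P)) cyc))

≤2+-cases : ∀ {v} j → v ≤ 2 + j → v ≤ j ⊎ v ≡ suc j ⊎ v ≡ 2 + j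
≤2+-cases j v≤ with m≤n⇒m<n∨m≡n v≤
... | inj₂ v≡        = inj₂ (inj₂ v≡)
... | inj₁ (s≤s v<) with m≤n⇒m<n∨m≡n v<
...   | inj₂ v≡       = inj₂ (inj₁ v≡)
...   | inj₁ (s≤s v≤j) = inj₁ v≤j

labelCycle-trues : ∀ m → LabelCycle (suc m) (onLabels (zigzag 0 (replicate m true))) 1 (interval 2 m ++ [ 2 + m ])
labelCycle-trues m = record
  { mapsAlong = mapsAlong-interval 1 m [ 2 + m ]
      (λ i i<m → cong suc (trans (zigzag-trues 0 m i) (cycleUp-step (suc m) z≤n (m<n⇒m<1+n i<m))))
      ( cong suc (trans (zigzag-trues 0 m m) (cycleUp-step (suc m) z≤n (n<1+n m)))
      , cong suc (trans (zigzag-trues 0 m (suc m)) (cycleUp-top 0 (suc m))))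
  ; covers = λ v v≤ → subst (suc v ∈_) (interval-snoc 1 (suc m)) (∈-interval (2 + m) (s≤s z≤n) (s≤s (s≤s v≤)))
  }

labelCycle-truesFalse : ∀ j → LabelCycle (2 + j) (onLabels (zigzag 0 (replicate j true ++ [ false ])))
                                         1 ((interval 2 j ++ [ 3 + j ]) ++ [ 2 + j ])
labelCycle-truesFalse j = record
  { mapsAlong = subst (λ M → MapsAlong τ (1 ∷ M) 1) (sym (++-assoc (interval 2 j) [ 3 + j ] [ 2 + j ]))
      (mapsAlong-interval 1 j ((3 + j) ∷ [ 2 + j ])
        (λ i i<j → cong suc (trans (eval i) (trans (cong (cycleUp 0 j) (trans (cong (swapAdj (suc j)) (swapAdj-below i<j))
                                                                                (swapAdj-below (m<n⇒m<1+n i<j))))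
                                                    (cycleUp-step j z≤n i<j))))
        ( cong suc (trans (eval j) (trans (cong (λ x → cycleUp 0 j (swapAdj (suc j) x)) (swapAdj-here j))
                                   (trans (cong (cycleUp 0 j) (swapAdj-here (suc j))) (cycleUp-above j (m<n⇒m<1+n (n<1+n j))))))
        , cong suc (trans (eval (2 + j)) (trans (cong (λ x → cycleUp 0 j (swapAdj (suc j) x)) (swapAdj-above ≤-refl))
                                         (trans (cong (cycleUp 0 j) (swapAdj-there (suc j))) (cycleUp-above j (n<1+n j)))))
        , cong suc (trans (eval (suc j)) (trans (cong (λ x → cycleUp 0 j (swapAdj (suc j) x)) (swapAdj-there j))
                                         (trans (cong (cycleUp 0 j) (swapAdj-below (n<1+n j))) (cycleUp-top 0 j))))))
  ; covers = λ v v≤ → covers (≤2+-cases j v≤)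
  }
  where
  τ = onLabels (zigzag 0 (replicate j true ++ [ false ]))
  eval : ∀ v → zigzag 0 (replicate j true ++ [ false ]) v ≡ cycleUp 0 j (swapAdj (suc j) (swapAdj j v))
  eval v = zigzag-trues-++ 0 j [ false ] v
  covers : ∀ {v} → v ≤ j ⊎ v ≡ suc j ⊎ v ≡ 2 + j → suc v ∈ 1 ∷ (interval 2 j ++ [ 3 + j ]) ++ [ 2 + j ]
  covers (inj₁ v≤j)        = ∈-++⁺ˡ (∈-++⁺ˡ (∈-interval (suc j) (s≤s z≤n) (s≤s (s≤s v≤j))))
  covers (inj₂ (inj₁ refl)) = ∈-++⁺ʳ (1 ∷ interval 2 j ++ [ 3 + j ]) (here refl)
  covers (inj₂ (inj₂ refl)) = ∈-++⁺ˡ (∈-++⁺ʳ (1 ∷ interval 2 j) (here refl))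

labelCycle-falseTrues : ∀ j → LabelCycle (2 + j) (onLabels (zigzag 0 (false ∷ replicate j true))) 1 (interval 3 (suc j) ++ [ 2 ])
labelCycle-falseTrues j = record
  { mapsAlong =
      cong suc (trans (eval 0) (cycleUp-step (suc j) ≤-refl (s≤s (s≤s z≤n)))) ,
      mapsAlong-interval 3 j [ 2 ]
        (λ i i<j → cong suc (trans (eval (2 + i)) (cycleUp-step (suc j) (s≤s z≤n) (s≤s (s≤s i<j)))))
        ( cong suc (trans (eval (2 + j)) (cycleUp-top 1 (suc j)))
        , cong suc (trans (eval 1) (cycleUp-below (suc j) (s≤s z≤n))))
  ; covers = covers
  }
  where
  eval : ∀ v → zigzag 0 (false ∷ replicate j true) v ≡ cycleUp 1 (suc j) (swapAdj 0 v)
  eval v = zigzag-trues 1 j (swapAdj 0 v)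
  covers : ∀ v → v ≤ 2 + j → suc v ∈ 1 ∷ interval 3 (suc j) ++ [ 2 ]
  covers zero          _                 = here refl
  covers (suc zero)    _                 = there (∈-++⁺ʳ (interval 3 (suc j)) (here refl))
  covers (suc (suc v)) (s≤s (s≤s v≤1+j)) =
    there (∈-++⁺ˡ (∈-interval (suc j) (s≤s (s≤s (s≤s z≤n))) (s≤s (s≤s (s≤s (s≤s v≤1+j))))))

cycFull-interval : ∀ m → cycFull (suc m) ≡ 1 ∷ interval 2 m ++ [ 2 + m ]
cycFull-interval m = trans (map-upTo-interval suc 1 (2 + m) (λ _ → refl)) (interval-snoc 1 (suc m))

cycA-interval : ∀ j → cycA (2 + j) ≡ 1 ∷ (interval 2 j ++ [ 3 + j ]) ++ [ 2 + j ]
cycA-interval j = trans (cong (_++ (3 + j) ∷ [ 2 + j ]) (map-upTo-interval suc 1 (suc j) (λ _ → refl)))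
                        (cong (1 ∷_) (sym (++-assoc (interval 2 j) [ 3 + j ] [ 2 + j ])))

cycB-interval : ∀ j → cycB (2 + j) ≡ 1 ∷ interval 3 (suc j) ++ [ 2 ]
cycB-interval j = cong (λ M → 1 ∷ M ++ [ 2 ]) (map-upTo-interval (3 +_) 3 (suc j) (λ _ → refl))

cycle-trues : ∀ m → CycleOfPattern (suc m) (replicate m true) (cycFull (suc m))
cycle-trues m = subst (CycleOfPattern _ _) (sym (cycFull-interval m)) (cycleOfPattern (labelCycle-trues m))

cycle-falses : ∀ m → CycleOfPattern (suc m) (replicate m false) (reverse (cycFull (suc m)))
cycle-falses m = subst (λ P → CycleOfPattern (suc m) P (reverse (cycFull (suc m)))) (map-replicate not m true)
  (cycleOfPattern-flip (replicate m true) (interval 2 m) (cycFull-interval m) (labelCycle-trues m))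

cycle-truesFalse : ∀ j → CycleOfPattern (2 + j) (replicate j true ++ [ false ]) (cycA (2 + j))
cycle-truesFalse j = subst (CycleOfPattern _ _) (sym (cycA-interval j)) (cycleOfPattern (labelCycle-truesFalse j))

cycle-falsesTrue : ∀ j → CycleOfPattern (2 + j) (replicate j false ++ [ true ]) (reverse (cycA (2 + j)))
cycle-falsesTrue j = subst (λ P → CycleOfPattern (2 + j) P (reverse (cycA (2 + j))))
  (trans (map-++ not (replicate j true) [ false ]) (cong (_++ [ true ]) (map-replicate not j true)))
  (cycleOfPattern-flip (replicate j true ++ [ false ]) (interval 2 j ++ [ 3 + j ]) (cycA-interval j) (labelCycle-truesFalse j))

cycle-falseTrues : ∀ j → CycleOfPattern (2 + j) (false ∷ replicate j true) (cycB (2 + j))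
cycle-falseTrues j = subst (CycleOfPattern _ _) (sym (cycB-interval j)) (cycleOfPattern (labelCycle-falseTrues j))

cycle-trueFalses : ∀ j → CycleOfPattern (2 + j) (true ∷ replicate j false) (reverse (cycB (2 + j)))
cycle-trueFalses j = subst (λ P → CycleOfPattern (2 + j) P (reverse (cycB (2 + j))))
  (cong (true ∷_) (map-replicate not j true))
  (cycleOfPattern-flip (false ∷ replicate j true) (interval 3 (suc j)) (cycB-interval j) (labelCycle-falseTrues j))

weightedCount-exceptional : ∀ {j P} → Exceptional j P → weightedCount P (const 1) ≡ suc j
weightedCount-exceptional {j} truesFalse =
  trans (weightedCount-trues-false j (const 1)) (trans (cong (_+ 1) (*-identityʳ j)) (+-comm j 1))
weightedCount-exceptional {j} falsesTrue = trans (weightedCount-falses-true j (const 1)) (cong suc (*-identityʳ j))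
weightedCount-exceptional {j} falseTrues =
  trans (weightedCount-trues j _) (trans (cong (prefixSum (const 1)) (length-replicate j)) (prefixSum-const j))
weightedCount-exceptional {j} trueFalses = trans (weightedCount-falses j (prefixSum (const 1))) (prefixSum-const j)

length-exceptional : ∀ {j P} → Exceptional j P → length P ≡ suc j
length-exceptional {j} truesFalse = length-replicate-snoc j true false
length-exceptional {j} falsesTrue = length-replicate-snoc j false true
length-exceptional {j} falseTrues = cong suc (length-replicate j)
length-exceptional {j} trueFalses = cong suc (length-replicate j)

ExceptionalCycle : ∀ n → (Fin (suc n) → Fin (suc n)) → Set
ExceptionalCycle n σ = IsCycle n σ (cycA n) ⊎ IsCycle n σ (reverse (cycA n))
                       ⊎ IsCycle n σ (cycB n) ⊎ IsCycle n σ (reverse (cycB n))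

exceptional-isCycle : ∀ {j P} (σ : Fin (3 + j) → Fin (3 + j)) → Exceptional j P → IsZigzag σ P →
                      ExceptionalCycle (2 + j) σ
exceptional-isCycle {j} σ truesFalse σ≗P = inj₁ (isCycle-zigzag σ σ≗P (cycle-truesFalse j))
exceptional-isCycle {j} σ falsesTrue σ≗P = inj₂ (inj₁ (isCycle-zigzag σ σ≗P (cycle-falsesTrue j)))
exceptional-isCycle {j} σ falseTrues σ≗P = inj₂ (inj₂ (inj₁ (isCycle-zigzag σ σ≗P (cycle-falseTrues j))))
exceptional-isCycle {j} σ trueFalses σ≗P = inj₂ (inj₂ (inj₂ (isCycle-zigzag σ σ≗P (cycle-trueFalses j))))

isCycle-exceptional : ∀ j (σ : Fin (3 + j) → Fin (3 + j)) → ExceptionalCycle (2 + j) σ →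
                      ∃ λ P → Exceptional j P × IsZigzag σ P
isCycle-exceptional j σ (inj₁ σ-cycle)               = _ , truesFalse , zigzag-isCycle σ σ-cycle (cycle-truesFalse j)
isCycle-exceptional j σ (inj₂ (inj₁ σ-cycle))        = _ , falsesTrue , zigzag-isCycle σ σ-cycle (cycle-falsesTrue j)
isCycle-exceptional j σ (inj₂ (inj₂ (inj₁ σ-cycle))) = _ , falseTrues , zigzag-isCycle σ σ-cycle (cycle-falseTrues j)
isCycle-exceptional j σ (inj₂ (inj₂ (inj₂ σ-cycle))) = _ , trueFalses , zigzag-isCycle σ σ-cycle (cycle-trueFalses j)

multiplicity-lowerBound : ∀ i (σ : Fin (4 + i) → Fin (4 + i)) → 1 ≤ multiplicity (3 + i) σ →
                          ¬ IsCycle (3 + i) σ (cycFull (3 + i)) → ¬ IsCycle (3 + i) σ (reverse (cycFull (3 + i))) →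
                          2 + i ≤ multiplicity (3 + i) σ
multiplicity-lowerBound i σ realised not-full not-reversed with realised-isZigzag (2 + i) σ realised
... | P , |P|≡ , σ≗P with classify i P |P|≡
...   | trues         = ⊥-elim (not-full (isCycle-zigzag σ σ≗P (cycle-trues (2 + i))))
...   | falses        = ⊥-elim (not-reversed (isCycle-zigzag σ σ≗P (cycle-falses (2 + i))))
...   | exceptional e =
  ≤-reflexive (sym (trans (multiplicity-zigzag (2 + i) σ P |P|≡ σ≗P) (weightedCount-exceptional e)))
...   | large more    = <⇒≤ (subst (2 + i <_) (sym (multiplicity-zigzag (2 + i) σ P |P|≡ σ≗P)) more)

multiplicity-exceptional : ∀ i (σ : Fin (4 + i) → Fin (4 + i)) → multiplicity (3 + i) σ ≡ 2 + i →
                           ExceptionalCycle (3 + i) σ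
multiplicity-exceptional i σ mult≡ with realised-isZigzag (2 + i) σ (subst (1 ≤_) (sym mult≡) (s≤s z≤n))
... | P , |P|≡ , σ≗P with classify i P |P|≡ | multiplicity-zigzag (2 + i) σ P |P|≡ σ≗P
...   | trues         | mult≡count = ⊥-elim (<-irrefl
  (trans (sym (weightedCount-trues (2 + i) (const 1))) (trans (sym mult≡count) mult≡)) (s≤s (s≤s z≤n)))
...   | falses        | mult≡count = ⊥-elim (<-irrefl
  (trans (sym (weightedCount-falses (2 + i) (const 1))) (trans (sym mult≡count) mult≡)) (s≤s (s≤s z≤n)))
...   | exceptional e | _          = exceptional-isCycle σ e σ≗P
...   | large more    | mult≡count = ⊥-elim (<-irrefl refl (subst (2 + i <_) (trans (sym mult≡count) mult≡) more))

exceptional-multiplicity : ∀ j (σ : Fin (3 + j) → Fin (3 + j)) → ExceptionalCycle (2 + j) σ →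
                           multiplicity (2 + j) σ ≡ suc j
exceptional-multiplicity j σ σ-cycle with isCycle-exceptional j σ σ-cycle
... | P , e , σ≗P = trans (multiplicity-zigzag (suc j) σ P (length-exceptional e) σ≗P) (weightedCount-exceptional e)

proposition3p16 : ∀ (n : ℕ) → 4 ≤ n →
    (∀ (σ : Fin (suc n) → Fin (suc n)) → 1 ≤ multiplicity n σ →
      ¬ IsCycle n σ (cycFull n) → ¬ IsCycle n σ (reverse (cycFull n)) →
      n ∸ 1 ≤ multiplicity n σ)
    × (∀ (σ : Fin (suc n) → Fin (suc n)) →
      (multiplicity n σ ≡ n ∸ 1) ⇔
        (IsCycle n σ (cycA n) ⊎ IsCycle n σ (reverse (cycA n))
          ⊎ IsCycle n σ (cycB n) ⊎ IsCycle n σ (reverse (cycB n))))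
-- The argument only needs n ≥ 3.
proposition3p16 (suc (suc (suc i))) (s≤s (s≤s (s≤s _))) =
  multiplicity-lowerBound i ,
  λ σ → mk⇔ (multiplicity-exceptional i σ) (exceptional-multiplicity (suc i) σ)
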